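{- Let $n$ be a composite integer which is not the square of a prime, and let $\mathcal{I}$ be the set of proper divisors $x$ of $n$ with $x\le\sqrt{n}$. Then $\mathcal{I}$ is an independent set in $\Upsilon_n$ of maximum size, and the independence number satisfies $\alpha(\Upsilon_n)=|\mathcal{I}|=\lceil\pi(n)/2\rceil$.
   Context: For an integer $n>1$, a proper divisor of $n$ is an integer $d$ with $1<d<n$ and $d\mid n$; $\pi(n)$ denotes the number of proper divisors of $n$. The proper divisor graph $\Upsilon_n$ is the simple graph whose vertices are the proper divisors of $n$, two distinct vertices $u,v$ being adjacent iff $n\mid uv$. -}

module Defs where

open import Data.Nat using (ℕ; _<_; _≤_; _*_; _<?_; _≤?_)
open import Data.Nat.Divisibility using (_∣_; _∣?_)
open import Data.List using (List; filter; upTo; length)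
open import Data.List.Relation.Unary.All using (All)
open import Data.List.Relation.Unary.AllPairs using (AllPairs)
open import Data.List.Relation.Unary.Unique.Propositional using (Unique)
open import Data.Product using (_×_; ∃)
open import Relation.Nullary using (¬_)
open import Relation.Nullary.Decidable using (_×-dec_)
open import Relation.Binary.PropositionalEquality using (_≡_; _≢_)

ProperDivisor : ℕ → ℕ → Set
ProperDivisor n d = 1 < d × d < n × d ∣ n

properDivisors : ℕ → List ℕ
properDivisors n = filter (λ d → (1 <? d) ×-dec ((d <? n) ×-dec (d ∣? n))) (upTo n)

πd : ℕ → ℕ
πd n = length (properDivisors n)

Adjacent : ℕ → ℕ → ℕ → Set
Adjacent n u v = u ≢ v × n ∣ u * v

IsIndependent : ℕ → List ℕ → Set
IsIndependent n S =
  Unique S × All (ProperDivisor n) S × AllPairs (λ u v → ¬ Adjacent n u v) S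

IsMaximumIndependent : ℕ → List ℕ → Set
IsMaximumIndependent n S =
  IsIndependent n S × (∀ T → IsIndependent n T → length T ≤ length S)

IsIndependenceNumber : ℕ → ℕ → Set
IsIndependenceNumber n k =
  ∃ (λ S → IsIndependent n S × length S ≡ k) ×
  (∀ T → IsIndependent n T → length T ≤ k)

smallDivisors : ℕ → List ℕ
smallDivisors n = filter (λ x → (x * x) ≤? n) (properDivisors n)

-- The map d ↦ n / d is an involution of the proper divisors of n exchanging
-- the small ones (d * d ≤ n) with the large ones, except that it fixes √n when
-- n is a square. Hence |𝓘| is |large| or |large| + 1, i.e. ⌈π(n)/2⌉. Two
-- distinct small divisors have product below n, so 𝓘 is independent. For
-- maximality, send each vertex of an independent set to itself if small and
-- to its cofactor if large: a collision would make a small x and a large y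
-- with x * y = n both members, and they are adjacent.
module Submission where

open import Defs
open import Data.Nat
  using (ℕ; zero; suc; _+_; _*_; _<_; _≤_; _<?_; _≤?_; _≟_; z≤n; z<s; s≤s; ⌈_/2⌉; >-nonZero)
open import Data.Nat.Properties
open import Data.Nat.Divisibility using (_∣_; _∣?_; divides; ∣-reflexive; >⇒∤)
open import Data.Nat.DivMod using (_/_; m*[n/m]≡n)
open import Data.Nat.Primality using (Composite; Prime)
open import Data.List using (List; []; _∷_; length; filter; upTo)
open import Data.List.Properties using (length-removeAt′)
open import Data.List.Membership.Propositional using (_∈_)
open import Data.List.Membership.Propositional.Properties using (∈-filter⁻; ∈-filter⁺; ∈-upTo⁺)
open import Data.List.Relation.Unary.Any using (here; there; index; _─_)
open import Data.List.Relation.Unary.All as All using (All; []; _∷_)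
open import Data.List.Relation.Unary.AllPairs using (AllPairs; []; _∷_)
open import Data.List.Relation.Unary.Unique.Propositional using (Unique)
import Data.List.Relation.Unary.Unique.Propositional.Properties as Unique
open import Data.Product using (_×_; _,_; proj₁; proj₂; ∃)
open import Data.Sum using (inj₁; inj₂)
open import Function using (id; _∘_)
open import Level using (_⊔_)
open import Relation.Nullary using (¬_; yes; no; contradiction)
open import Relation.Nullary.Decidable using (_×-dec_)
open import Relation.Unary using (Pred; Decidable)
open import Relation.Unary.Properties using (∁?)
open import Relation.Binary.Core using (Rel)
open import Relation.Binary.Definitions using (Reflexive; Symmetric; tri<; tri≈; tri>)
open import Relation.Binary.PropositionalEquality
  using (_≡_; _≢_; refl; sym; trans; cong; subst; module ≡-Reasoning)

∈-─⁺ : ∀ {a} {A : Set a} {x y} {ys : List A} (y∈ys : y ∈ ys) → x ∈ ys → x ≢ y → x ∈ (ys ─ y∈ys)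
∈-─⁺ (here refl)  (here refl)  x≢y = contradiction refl x≢y
∈-─⁺ (here _)     (there x∈ys) _   = x∈ys
∈-─⁺ (there _)    (here x≡y₀)  _   = here x≡y₀
∈-─⁺ (there y∈ys) (there x∈ys) x≢y = there (∈-─⁺ y∈ys x∈ys x≢y)

module _ {a} {A : Set a} where

  InjectiveOn : ∀ {b} {B : Set b} → (A → B) → List A → Set (a ⊔ b)
  InjectiveOn f xs = ∀ {x y} → x ∈ xs → y ∈ xs → f x ≡ f y → x ≡ y

  injectiveOn⇒length-≤ : ∀ {b} {B : Set b} (f : A → B) {xs ys} → Unique xs →
                         (∀ {x} → x ∈ xs → f x ∈ ys) → InjectiveOn f xs →
                         length xs ≤ length ys
  injectiveOn⇒length-≤ f {[]}     _             _    _   = z≤n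
  injectiveOn⇒length-≤ f {x ∷ xs} {ys} (x∉xs ∷ xs!) into inj = begin
    suc (length xs)           ≤⟨ s≤s (injectiveOn⇒length-≤ f xs! into′ (λ p q → inj (there p) (there q))) ⟩
    suc (length (ys ─ fx∈ys)) ≡⟨ length-removeAt′ ys (index fx∈ys) ⟨
    length ys                 ∎
    where
    open ≤-Reasoning
    fx∈ys : f x ∈ ys
    fx∈ys = into (here refl)
    into′ : ∀ {y} → y ∈ xs → f y ∈ (ys ─ fx∈ys)
    into′ y∈xs = ∈-─⁺ fx∈ys (into (there y∈xs))
      (λ fy≡fx → All.lookup x∉xs y∈xs (inj (here refl) (there y∈xs) (sym fy≡fx)))

  AllPairs-lookup : ∀ {r} {R : Rel A r} → Reflexive R → Symmetric R →
                    ∀ {xs x y} → AllPairs R xs → x ∈ xs → y ∈ xs → R x y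
  AllPairs-lookup refl-R sym-R (_ ∷ _)    (here refl) (here refl) = refl-R
  AllPairs-lookup refl-R sym-R (Rx ∷ _)   (here refl) (there y∈) = All.lookup Rx y∈
  AllPairs-lookup refl-R sym-R (Rx ∷ _)   (there x∈)  (here refl) = sym-R (All.lookup Rx x∈)
  AllPairs-lookup refl-R sym-R (_ ∷ Rxs)  (there x∈)  (there y∈) = AllPairs-lookup refl-R sym-R Rxs x∈ y∈

  All∧AllPairs⇒AllPairs : ∀ {p r s} {P : Pred A p} {R : Rel A r} {S : Rel A s} →
                        (∀ {x y} → P x → P y → R x y → S x y) →
                        ∀ {xs} → All P xs → AllPairs R xs → AllPairs S xs
  All∧AllPairs⇒AllPairs f []         []         = []
  All∧AllPairs⇒AllPairs f (px ∷ pxs) (Rx ∷ Rxs) =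
    All.zipWith (λ (py , Rxy) → f px py Rxy) (pxs , Rx) ∷ All∧AllPairs⇒AllPairs f pxs Rxs

  length-filter+length-filter-∁ : ∀ {p} {P : Pred A p} (P? : Decidable P) xs →
    length (filter P? xs) + length (filter (∁? P?) xs) ≡ length xs
  length-filter+length-filter-∁ P? []       = refl
  length-filter+length-filter-∁ P? (x ∷ xs) with P? x
  ... | yes _ = cong suc (length-filter+length-filter-∁ P? xs)
  ... | no  _ = trans (+-suc _ _) (cong suc (length-filter+length-filter-∁ P? xs))

⌈m+n/2⌉≡m : ∀ {m n} → n ≤ m → m ≤ suc n → ⌈ m + n /2⌉ ≡ m
⌈m+n/2⌉≡m {m} {n} n≤m m≤1+n with m≤n⇒m<n∨m≡n n≤m
... | inj₂ refl = sym (n≡⌈n+n/2⌉ m)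
... | inj₁ n<m with ≤-antisym m≤1+n n<m
...   | refl = cong suc (sym (n≡⌊n+n/2⌋ n))

m*m≡n*n⇒m≡n : ∀ {m n} → m * m ≡ n * n → m ≡ n
m*m≡n*n⇒m≡n {m} {n} eq with <-cmp m n
... | tri< m<n _ _ = contradiction eq (<⇒≢ (*-mono-< m<n m<n))
... | tri≈ _ m≡n _ = m≡n
... | tri> _ _ m>n = contradiction eq (>⇒≢ (*-mono-< m>n m>n))

large-factor⇒small-cofactor : ∀ m k {n} → m * k ≡ n → n < m * m → k * k ≤ n
large-factor⇒small-cofactor m k {n} mk≡n n<mm = begin
  k * k ≤⟨ *-monoʳ-≤ k (<⇒≤ k<m) ⟩
  k * m ≡⟨ *-comm k m ⟩
  m * k ≡⟨ mk≡n ⟩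
  n     ∎
  where
  open ≤-Reasoning
  k<m : k < m
  k<m = *-cancelˡ-< m k m (subst (_< m * m) (sym mk≡n) n<mm)

small-factor⇒large-cofactor : ∀ m k {n} → m * k ≡ n → m * m < n → n < k * k
small-factor⇒large-cofactor m k {n} mk≡n mm<n =
  subst (_< k * k) mk≡n (*-monoˡ-< k {{>-nonZero (≤-<-trans z≤n m<k)}} m<k)
  where
  m<k : m < k
  m<k = *-cancelˡ-< m m k (subst (m * m <_) (sym mk≡n) mm<n)

small-factors⇒product< : ∀ {u v n} → u < v → v * v ≤ n → u * v < n
small-factors⇒product< {u} {v} u<v vv≤n =
  <-≤-trans (*-monoˡ-< v {{>-nonZero (≤-<-trans z≤n u<v)}} u<v) vv≤n

properDivisor-positive : ∀ {n d} → ProperDivisor n d → 0 < d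
properDivisor-positive (1<d , _) = <-trans z<s 1<d

properDivisor-cofactor : ∀ {n d k} → 1 < d → d < n → d * k ≡ n → ProperDivisor n k
properDivisor-cofactor {d = d} {zero} _ d<n dk≡n =
  contradiction (trans (sym (*-zeroʳ d)) dk≡n) (<⇒≢ (≤-<-trans z≤n d<n))
properDivisor-cofactor {d = d} {suc zero} _ d<n dk≡n =
  contradiction (trans (sym (*-identityʳ d)) dk≡n) (<⇒≢ d<n)
properDivisor-cofactor {d = d} {k@(suc (suc _))} 1<d _ dk≡n =
  s≤s (s≤s z≤n) ,
  subst (k <_) (trans (*-comm k d) dk≡n) (m<m*n k d 1<d) ,
  divides d (sym dk≡n)

module _ (n : ℕ) where

  properDivisor? : Decidable (ProperDivisor n)
  properDivisor? d = (1 <? d) ×-dec ((d <? n) ×-dec (d ∣? n))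

  small? : Decidable (λ x → x * x ≤ n)
  small? x = x * x ≤? n

  largeDivisors : List ℕ
  largeDivisors = filter (∁? small?) (properDivisors n)

  ∈-properDivisors⁺ : ∀ {d} → ProperDivisor n d → d ∈ properDivisors n
  ∈-properDivisors⁺ pd@(_ , d<n , _) = ∈-filter⁺ properDivisor? (∈-upTo⁺ d<n) pd

  ∈-properDivisors⁻ : ∀ {d} → d ∈ properDivisors n → ProperDivisor n d
  ∈-properDivisors⁻ = proj₂ ∘ ∈-filter⁻ properDivisor? {xs = upTo n}

  ∈-smallDivisors⁺ : ∀ {d} → ProperDivisor n d → d * d ≤ n → d ∈ smallDivisors n
  ∈-smallDivisors⁺ pd = ∈-filter⁺ small? (∈-properDivisors⁺ pd)

  ∈-smallDivisors⁻ : ∀ {d} → d ∈ smallDivisors n → ProperDivisor n d × d * d ≤ n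
  ∈-smallDivisors⁻ d∈ with d∈PD , small ← ∈-filter⁻ small? {xs = properDivisors n} d∈ =
    ∈-properDivisors⁻ d∈PD , small

  ∈-largeDivisors⁺ : ∀ {d} → ProperDivisor n d → ¬ d * d ≤ n → d ∈ largeDivisors
  ∈-largeDivisors⁺ pd = ∈-filter⁺ (∁? small?) (∈-properDivisors⁺ pd)

  ∈-largeDivisors⁻ : ∀ {d} → d ∈ largeDivisors → ProperDivisor n d × ¬ d * d ≤ n
  ∈-largeDivisors⁻ d∈ with d∈PD , large ← ∈-filter⁻ (∁? small?) {xs = properDivisors n} d∈ =
    ∈-properDivisors⁻ d∈PD , large

  properDivisors-unique : Unique (properDivisors n)
  properDivisors-unique = Unique.filter⁺ properDivisor? (Unique.upTo⁺ n)

  smallDivisors-unique : Unique (smallDivisors n)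
  smallDivisors-unique = Unique.filter⁺ small? properDivisors-unique

  largeDivisors-unique : Unique largeDivisors
  largeDivisors-unique = Unique.filter⁺ (∁? small?) properDivisors-unique

  length-small+length-large : length (smallDivisors n) + length largeDivisors ≡ πd n
  length-small+length-large = length-filter+length-filter-∁ small? (properDivisors n)

  cofactor : ℕ → ℕ
  cofactor zero        = 0
  cofactor d@(suc _)   = n / d

  *-cofactor : ∀ {d} → ProperDivisor n d → d * cofactor d ≡ n
  *-cofactor {suc _} (_ , _ , d∣n) = m*[n/m]≡n d∣n

  cofactor-proper : ∀ {d} → ProperDivisor n d → ProperDivisor n (cofactor d)
  cofactor-proper pd@(1<d , d<n , _) = properDivisor-cofactor 1<d d<n (*-cofactor pd)

  cofactor-injective : ∀ {x y} → ProperDivisor n x → ProperDivisor n y →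
                       cofactor x ≡ cofactor y → x ≡ y
  cofactor-injective {x} {y} px py cx≡cy =
    *-cancelʳ-≡ x y (cofactor y) {{>-nonZero (properDivisor-positive (cofactor-proper py))}}
      (trans (subst (λ c → x * c ≡ n) cx≡cy (*-cofactor px)) (sym (*-cofactor py)))

  cofactor-∈-smallDivisors : ∀ {d} → ProperDivisor n d → ¬ d * d ≤ n →
                             cofactor d ∈ smallDivisors n
  cofactor-∈-smallDivisors {d} pd large = ∈-smallDivisors⁺ (cofactor-proper pd)
    (large-factor⇒small-cofactor d (cofactor d) (*-cofactor pd) (≰⇒> large))

  cofactor-∈-largeDivisors : ∀ {d} → ProperDivisor n d → d * d ≤ n → d * d ≢ n →
                             cofactor d ∈ largeDivisors
  cofactor-∈-largeDivisors {d} pd small d*d≢n = ∈-largeDivisors⁺ (cofactor-proper pd)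
    (<⇒≱ (small-factor⇒large-cofactor d (cofactor d) (*-cofactor pd) (≤∧≢⇒< small d*d≢n)))

  ¬Adjacent-refl : Reflexive (λ u v → ¬ Adjacent n u v)
  ¬Adjacent-refl (u≢u , _) = u≢u refl

  ¬Adjacent-sym : Symmetric (λ u v → ¬ Adjacent n u v)
  ¬Adjacent-sym {u} {v} ¬adj (v≢u , n∣vu) = ¬adj (v≢u ∘ sym , subst (n ∣_) (*-comm v u) n∣vu)

  smallDivisors-independent : IsIndependent n (smallDivisors n)
  smallDivisors-independent =
    smallDivisors-unique ,
    All.tabulate (proj₁ ∘ ∈-smallDivisors⁻) ,
    All∧AllPairs⇒AllPairs nonAdjacent (All.tabulate ∈-smallDivisors⁻) smallDivisors-unique
    where
    nonAdjacent : ∀ {u v} → ProperDivisor n u × u * u ≤ n → ProperDivisor n v × v * v ≤ n →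
                  u ≢ v → ¬ Adjacent n u v
    nonAdjacent {u} {v} (pu , uu≤n) (pv , vv≤n) _ (u≢v , n∣uv) =
      >⇒∤ {{m*n≢0 u v {{>-nonZero (properDivisor-positive pu)}} {{>-nonZero (properDivisor-positive pv)}}}}
        uv<n n∣uv
      where
      uv<n : u * v < n
      uv<n with <-cmp u v
      ... | tri< u<v _ _ = small-factors⇒product< u<v vv≤n
      ... | tri≈ _ u≡v _ = contradiction u≡v u≢v
      ... | tri> _ _ u>v = subst (_< n) (*-comm v u) (small-factors⇒product< u>v uu≤n)

  cofactor-adjacent : ∀ {x y} → ProperDivisor n y → x ≡ cofactor y → x ≢ y → Adjacent n x y
  cofactor-adjacent {y = y} py refl x≢y =
    x≢y , ∣-reflexive (sym (trans (*-comm (cofactor y) y) (*-cofactor py)))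

  small≢large : ∀ {x y} → x * x ≤ n → ¬ y * y ≤ n → x ≢ y
  small≢large xx≤n yy≰n refl = yy≰n xx≤n

  toSmall : ℕ → ℕ
  toSmall x with small? x
  ... | yes _ = x
  ... | no  _ = cofactor x

  toSmall-∈-smallDivisors : ∀ {x} → ProperDivisor n x → toSmall x ∈ smallDivisors n
  toSmall-∈-smallDivisors {x} px with small? x
  ... | yes small = ∈-smallDivisors⁺ px small
  ... | no  large = cofactor-∈-smallDivisors px large

  toSmall-injective : ∀ {x y} → ProperDivisor n x → ProperDivisor n y → ¬ Adjacent n x y →
                      toSmall x ≡ toSmall y → x ≡ y
  toSmall-injective {x} {y} px py ¬adj with small? x | small? y
  ... | yes _      | yes _      = id
  ... | no  _      | no  _      = cofactor-injective px py
  ... | yes xsmall | no  ylarge = λ x≡cy →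
    contradiction (cofactor-adjacent py x≡cy (small≢large xsmall ylarge)) ¬adj
  ... | no  xlarge | yes ysmall = λ cx≡y →
    contradiction (cofactor-adjacent px (sym cx≡y) (small≢large ysmall xlarge)) (¬Adjacent-sym ¬adj)

  independent⇒length≤small : ∀ T → IsIndependent n T → length T ≤ length (smallDivisors n)
  independent⇒length≤small T (T-unique , T-proper , T-nonAdjacent) =
    injectiveOn⇒length-≤ toSmall T-unique
      (toSmall-∈-smallDivisors ∘ All.lookup T-proper)
      (λ x∈T y∈T → toSmall-injective (All.lookup T-proper x∈T) (All.lookup T-proper y∈T)
                     (AllPairs-lookup ¬Adjacent-refl ¬Adjacent-sym T-nonAdjacent x∈T y∈T))

  length-large≤length-small : length largeDivisors ≤ length (smallDivisors n)
  length-large≤length-small =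
    injectiveOn⇒length-≤ cofactor largeDivisors-unique
      (λ d∈ → let pd , large = ∈-largeDivisors⁻ d∈ in cofactor-∈-smallDivisors pd large)
      (λ x∈ y∈ → cofactor-injective (proj₁ (∈-largeDivisors⁻ x∈)) (proj₁ (∈-largeDivisors⁻ y∈)))

  -- √n, if it is a divisor, is sent to 0, which is not a proper divisor.
  toLarge : ℕ → ℕ
  toLarge x with x * x ≟ n
  ... | yes _ = 0
  ... | no  _ = cofactor x

  toLarge-∈ : ∀ {x} → x ∈ smallDivisors n → toLarge x ∈ 0 ∷ largeDivisors
  toLarge-∈ {x} x∈ with x * x ≟ n
  ... | yes _     = here refl
  ... | no  xx≢n  = let px , small = ∈-smallDivisors⁻ x∈ in there (cofactor-∈-largeDivisors px small xx≢n)

  toLarge-injective : ∀ {x y} → ProperDivisor n x → ProperDivisor n y → toLarge x ≡ toLarge y → x ≡ y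
  toLarge-injective {x} {y} px py with x * x ≟ n | y * y ≟ n
  ... | yes xx≡n | yes yy≡n = λ _ → m*m≡n*n⇒m≡n (trans xx≡n (sym yy≡n))
  ... | no  _    | no  _    = cofactor-injective px py
  ... | yes _    | no  _    = λ 0≡cy → contradiction 0≡cy (<⇒≢ (properDivisor-positive (cofactor-proper py)))
  ... | no  _    | yes _    = λ cx≡0 → contradiction cx≡0 (>⇒≢ (properDivisor-positive (cofactor-proper px)))

  length-small≤1+length-large : length (smallDivisors n) ≤ suc (length largeDivisors)
  length-small≤1+length-large =
    injectiveOn⇒length-≤ toLarge smallDivisors-unique toLarge-∈
      (λ x∈ y∈ → toLarge-injective (proj₁ (∈-smallDivisors⁻ x∈)) (proj₁ (∈-smallDivisors⁻ y∈)))

  length-smallDivisors : length (smallDivisors n) ≡ ⌈ πd n /2⌉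
  length-smallDivisors = begin
    length (smallDivisors n)                                ≡⟨ ⌈m+n/2⌉≡m length-large≤length-small length-small≤1+length-large ⟨
    ⌈ length (smallDivisors n) + length largeDivisors /2⌉  ≡⟨ cong ⌈_/2⌉ length-small+length-large ⟩
    ⌈ πd n /2⌉                                             ∎
    where open ≡-Reasoning

proposition5p8 : (n : ℕ) → Composite n → ¬ (∃ λ p → Prime p × n ≡ p * p) →
    IsMaximumIndependent n (smallDivisors n) ×
    IsIndependenceNumber n (length (smallDivisors n)) ×
    length (smallDivisors n) ≡ ⌈ πd n /2⌉
proposition5p8 n _ _ =
  (smallDivisors-independent n , independent⇒length≤small n) ,
  ((smallDivisors n , smallDivisors-independent n , refl) , independent⇒length≤small n) ,
  length-smallDivisors n
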